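{- Let $G$ be a finite simple graph. If $X \subseteq V(G)$ can be expressed as a union of one or more inclusion minimal sets with positive difference, then (i) $X$ is an independent set of $G$; (ii) $d(X)>0$; (iii) $d(Y)<d(X)$ for every proper subset $Y\subsetneq X$.
   Context: For $A \subseteq V(G)$, $N(A)$ is the set of vertices adjacent to some vertex of $A$, and $d(A)=|A|-|N(A)|$. A set $S \subseteq V(G)$ is an inclusion minimal set with positive difference if $d(S)>0$ and no proper subset of $S$ has positive difference. -}

module Defs where

open import Data.Bool using (Bool; true; false; _∧_; _∨_)
open import Data.Nat using (ℕ; zero; suc)
open import Data.Fin using (Fin)
import Data.Fin as F
open import Data.Fin.Subset using (Subset; _∈_; _⊂_; ∣_∣)
open import Data.Vec using (lookup; tabulate)
open import Data.Integer using (ℤ; +_; _-_; _<_; _≤_; 0ℤ)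
open import Data.List using (List; [])
open import Relation.Binary.PropositionalEquality using (_≡_)
open import Relation.Nullary using (¬_)

record Graph (n : ℕ) : Set where
  field
    adj   : Fin n → Fin n → Bool
    sym   : ∀ u v → adj u v ≡ adj v u
    irrefl : ∀ v → adj v v ≡ false
open Graph public

anyFin : ∀ {n} → (Fin n → Bool) → Bool
anyFin {zero}  f = false
anyFin {suc n} f = f F.zero ∨ anyFin (λ i → f (F.suc i))

module _ {n : ℕ} (G : Graph n) where

  N : Subset n → Subset n
  N A = tabulate (λ v → anyFin (λ u → lookup A u ∧ adj G u v))

  d : Subset n → ℤ
  d A = + ∣ A ∣ - + ∣ N A ∣

  MinimalPositive : Subset n → Set
  MinimalPositive S = (0ℤ < d S) × (∀ T → T ⊂ S → ¬ (0ℤ < d T))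
    where open import Data.Product using (_×_)

  Independent : Subset n → Set
  Independent X = ∀ u v → u ∈ X → v ∈ X → adj G u v ≡ false

-- The difference d is supermodular, because N(A ∪ B) = N(A) ∪ N(B) and
-- N(A ∩ B) ⊆ N(A) ∩ N(B).  Hence if S is minimal with positive difference and
-- S ⊈ Z, then Z ∩ S is a proper subset of S, so d(Z ∩ S) ≤ 0 < d(S) and
-- d(Z ∪ S) ≥ d(Z) + d(S) − d(Z ∩ S) > d(Z).  Adding the minimal sets one at a
-- time, d(Y) < d(Y ∪ X) = d(X) for every Y ⊂ X; this is (iii), and (ii) is the
-- case Y = ∅.  For (i), removing N(X) from X never decreases d, since the
-- removed vertices X ∩ N(X) and the new neighbourhood N(X ─ N(X)) are disjoint
-- parts of N(X); an edge inside X would make X ─ N(X) a proper subset.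
module Submission where

open import Defs
open import Data.Nat using (ℕ)
open import Data.List using (List; [])
open import Data.List.Relation.Unary.All using (All)
open import Data.Fin.Subset using (Subset; _⊂_; ⋃)
open import Data.Integer using (0ℤ; _<_)
open import Data.Product using (_×_; ∃)
open import Relation.Binary.PropositionalEquality using (_≡_)
open import Relation.Nullary using (¬_)

open import Data.Bool using (Bool; true; false; _∧_)
open import Data.Bool.Properties using (∨-zeroʳ)
open import Data.Fin as Fin using (Fin)
open import Data.Fin.Subset using (_∈_; _∉_; _⊆_; ∣_∣; _∪_; _∩_; _─_; ⊥; Nonempty; Empty)
open import Data.Fin.Subset.Properties
open import Data.Integer as ℤ using (ℤ; +_; _-_; _+_; _≤_)
import Data.Integer.Properties as ℤ
open import Data.Integer.Solver using (module +-*-Solver)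
open import Data.List using (_∷_)
open import Data.List.Relation.Unary.All using ([]; _∷_)
import Data.Nat as ℕ
import Data.Nat.Properties as ℕ
open import Data.Product using (_,_; proj₁; proj₂)
open import Data.Sum using (inj₁; inj₂; [_,_]′)
open import Function using (_∘_; id)
open import Data.Vec using ([]; _∷_; there)
open import Data.Vec.Properties using (lookup∘tabulate; []=⇒lookup; lookup⇒[]=)
open import Relation.Binary.PropositionalEquality as ≡ using (refl; trans; cong; cong₂; subst)
open import Relation.Nullary using (Dec; yes; no; contradiction)

[+a-+b]+[+c-+e]≡+[a+c]-+[b+e] : ∀ a b c e → (+ a - + b) + (+ c - + e) ≡ + (a ℕ.+ c) - + (b ℕ.+ e)
[+a-+b]+[+c-+e]≡+[a+c]-+[b+e] a b c e = begin
  (+ a - + b) + (+ c - + e)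
    ≡⟨ solve 4 (λ a b c e → (a :- b) :+ (c :- e) := (a :+ c) :- (b :+ e)) refl (+ a) (+ b) (+ c) (+ e) ⟩
  (+ a + + c) - (+ b + + e)   ≡⟨ ≡.sym (cong₂ _-_ (ℤ.pos-+ a c) (ℤ.pos-+ b e)) ⟩
  + (a ℕ.+ c) - + (b ℕ.+ e)   ∎
  where
  open +-*-Solver
  open ≡.≡-Reasoning

+[a+k]-+[b+k]≡+a-+b : ∀ a b k → + (a ℕ.+ k) - + (b ℕ.+ k) ≡ + a - + b
+[a+k]-+[b+k]≡+a-+b a b k = begin
  + (a ℕ.+ k) - + (b ℕ.+ k)   ≡⟨ ≡.sym ([+a-+b]+[+c-+e]≡+[a+c]-+[b+e] a b k k) ⟩
  (+ a - + b) + (+ k - + k)   ≡⟨ cong (λ z → (+ a - + b) + z) (ℤ.+-inverseʳ (+ k)) ⟩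
  (+ a - + b) + 0ℤ            ≡⟨ ℤ.+-identityʳ _ ⟩
  + a - + b                   ∎
  where open ≡.≡-Reasoning

i-j≤i′-j′ : ∀ {i i′ j j′ : ℤ} → i ≤ i′ → j′ ≤ j → i - j ≤ i′ - j′
i-j≤i′-j′ i≤i′ j′≤j = ℤ.+-mono-≤ i≤i′ (ℤ.neg-mono-≤ j′≤j)

∣p∪q∣+∣p∩q∣≡∣p∣+∣q∣ : ∀ {n} (p q : Subset n) → ∣ p ∪ q ∣ ℕ.+ ∣ p ∩ q ∣ ≡ ∣ p ∣ ℕ.+ ∣ q ∣
∣p∪q∣+∣p∩q∣≡∣p∣+∣q∣ []            []            = refl
∣p∪q∣+∣p∩q∣≡∣p∣+∣q∣ (true  ∷ p) (true  ∷ q) =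
  cong ℕ.suc (trans (ℕ.+-suc _ _) (trans (cong ℕ.suc (∣p∪q∣+∣p∩q∣≡∣p∣+∣q∣ p q)) (≡.sym (ℕ.+-suc _ _))))
∣p∪q∣+∣p∩q∣≡∣p∣+∣q∣ (true  ∷ p) (false ∷ q) = cong ℕ.suc (∣p∪q∣+∣p∩q∣≡∣p∣+∣q∣ p q)
∣p∪q∣+∣p∩q∣≡∣p∣+∣q∣ (false ∷ p) (true  ∷ q) = trans (cong ℕ.suc (∣p∪q∣+∣p∩q∣≡∣p∣+∣q∣ p q)) (≡.sym (ℕ.+-suc _ _))
∣p∪q∣+∣p∩q∣≡∣p∣+∣q∣ (false ∷ p) (false ∷ q) = ∣p∪q∣+∣p∩q∣≡∣p∣+∣q∣ p q

∣p─q∣+∣p∩q∣≡∣p∣ : ∀ {n} (p q : Subset n) → ∣ p ─ q ∣ ℕ.+ ∣ p ∩ q ∣ ≡ ∣ p ∣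
∣p─q∣+∣p∩q∣≡∣p∣ []          []          = refl
∣p─q∣+∣p∩q∣≡∣p∣ (true  ∷ p) (true  ∷ q) = trans (ℕ.+-suc _ _) (cong ℕ.suc (∣p─q∣+∣p∩q∣≡∣p∣ p q))
∣p─q∣+∣p∩q∣≡∣p∣ (true  ∷ p) (false ∷ q) = cong ℕ.suc (∣p─q∣+∣p∩q∣≡∣p∣ p q)
∣p─q∣+∣p∩q∣≡∣p∣ (false ∷ p) (true  ∷ q) = ∣p─q∣+∣p∩q∣≡∣p∣ p q
∣p─q∣+∣p∩q∣≡∣p∣ (false ∷ p) (false ∷ q) = ∣p─q∣+∣p∩q∣≡∣p∣ p q

Empty⇒∣p∣≡0 : ∀ {n} {p : Subset n} → Empty p → ∣ p ∣ ≡ 0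
Empty⇒∣p∣≡0 {n} p-empty = trans (cong ∣_∣ (Empty-unique p-empty)) (∣⊥∣≡0 n)

disjoint⇒∣p∣+∣q∣≤∣r∣ : ∀ {n} {p q r : Subset n} → Empty (p ∩ q) → p ⊆ r → q ⊆ r → ∣ p ∣ ℕ.+ ∣ q ∣ ℕ.≤ ∣ r ∣
disjoint⇒∣p∣+∣q∣≤∣r∣ {p = p} {q} {r} p∩q-empty p⊆r q⊆r = begin
  ∣ p ∣ ℕ.+ ∣ q ∣              ≡⟨ ≡.sym (∣p∪q∣+∣p∩q∣≡∣p∣+∣q∣ p q) ⟩
  ∣ p ∪ q ∣ ℕ.+ ∣ p ∩ q ∣      ≡⟨ cong (∣ p ∪ q ∣ ℕ.+_) (Empty⇒∣p∣≡0 p∩q-empty) ⟩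
  ∣ p ∪ q ∣ ℕ.+ 0              ≡⟨ ℕ.+-identityʳ _ ⟩
  ∣ p ∪ q ∣                    ≤⟨ p⊆q⇒∣p∣≤∣q∣ p∪q⊆r ⟩
  ∣ r ∣                        ∎
  where
  open ℕ.≤-Reasoning
  p∪q⊆r : p ∪ q ⊆ r
  p∪q⊆r x∈p∪q with x∈p∪q⁻ p q x∈p∪q
  ... | inj₁ x∈p = p⊆r x∈p
  ... | inj₂ x∈q = q⊆r x∈q

x∈p─q⇒x∉q : ∀ {n} {x : Fin n} (p q : Subset n) → x ∈ p ─ q → x ∉ q
x∈p─q⇒x∉q (_ ∷ p) (true  ∷ q) (there x∈p─q) (there x∈q) = x∈p─q⇒x∉q p q x∈p─q x∈q
x∈p─q⇒x∉q (_ ∷ p) (false ∷ q) (there x∈p─q) (there x∈q) = x∈p─q⇒x∉q p q x∈p─q x∈q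

p⊆q⇒p∪q≡q : ∀ {n} {p q : Subset n} → p ⊆ q → p ∪ q ≡ q
p⊆q⇒p∪q≡q {p = p} {q} p⊆q = ⊆-antisym p∪q⊆q (q⊆p∪q p q)
  where
  p∪q⊆q : p ∪ q ⊆ q
  p∪q⊆q x∈p∪q with x∈p∪q⁻ p q x∈p∪q
  ... | inj₁ x∈p = p⊆q x∈p
  ... | inj₂ x∈q = x∈q

p⊆q∧p⊄q⇒q⊆p : ∀ {n} {p q : Subset n} → p ⊆ q → ¬ (p ⊂ q) → q ⊆ p
p⊆q∧p⊄q⇒q⊆p {p = p} p⊆q p⊄q {x} x∈q with x ∈? p
... | yes x∈p = x∈p
... | no  x∉p = contradiction ((λ {y} → p⊆q {y}) , x , x∈q , x∉p) p⊄q

anyFin⁻ : ∀ {n} (f : Fin n → Bool) → anyFin f ≡ true → ∃ λ i → f i ≡ true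
anyFin⁻ {ℕ.zero}  f ()
anyFin⁻ {ℕ.suc n} f any≡true with f Fin.zero in f0≡
... | true  = Fin.zero , f0≡
... | false with anyFin⁻ (λ i → f (Fin.suc i)) any≡true
...   | i , fi≡true = Fin.suc i , fi≡true

anyFin⁺ : ∀ {n} (f : Fin n → Bool) i → f i ≡ true → anyFin f ≡ true
anyFin⁺ f Fin.zero    fi≡true rewrite fi≡true = refl
anyFin⁺ f (Fin.suc i) fi≡true rewrite anyFin⁺ (λ j → f (Fin.suc j)) i fi≡true = ∨-zeroʳ (f Fin.zero)

∧-true⁻ : ∀ {a b} → a ∧ b ≡ true → a ≡ true × b ≡ true
∧-true⁻ {true} {true} refl = refl , refl

module _ {n : ℕ} (G : Graph n) where

  x∈N⁻ : ∀ {A x} → x ∈ N G A → ∃ λ u → u ∈ A × adj G u x ≡ true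
  x∈N⁻ {A} {x} x∈NA with anyFin⁻ _ (trans (≡.sym (lookup∘tabulate _ x)) ([]=⇒lookup x∈NA))
  ... | u , u∈A∧adj with ∧-true⁻ u∈A∧adj
  ...   | u∈A , adj≡true = u , lookup⇒[]= u A u∈A , adj≡true

  x∈N⁺ : ∀ {A x u} → u ∈ A → adj G u x ≡ true → x ∈ N G A
  x∈N⁺ {A} {x} {u} u∈A adj≡true =
    lookup⇒[]= x (N G A) (trans (lookup∘tabulate _ x) (anyFin⁺ _ u (cong₂ _∧_ ([]=⇒lookup u∈A) adj≡true)))

  N-mono : ∀ {A B} → A ⊆ B → N G A ⊆ N G B
  N-mono A⊆B x∈NA with x∈N⁻ x∈NA
  ... | u , u∈A , adj≡true = x∈N⁺ (A⊆B u∈A) adj≡true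

  N[A∪B]⊆N[A]∪N[B] : ∀ A B → N G (A ∪ B) ⊆ N G A ∪ N G B
  N[A∪B]⊆N[A]∪N[B] A B x∈N with x∈N⁻ x∈N
  ... | u , u∈A∪B , adj≡true with x∈p∪q⁻ A B u∈A∪B
  ...   | inj₁ u∈A = x∈p∪q⁺ (inj₁ (x∈N⁺ u∈A adj≡true))
  ...   | inj₂ u∈B = x∈p∪q⁺ (inj₂ (x∈N⁺ u∈B adj≡true))

  N[A∩B]⊆N[A]∩N[B] : ∀ A B → N G (A ∩ B) ⊆ N G A ∩ N G B
  N[A∩B]⊆N[A]∩N[B] A B x∈N = x∈p∩q⁺ (N-mono (p∩q⊆p A B) x∈N , N-mono (p∩q⊆q A B) x∈N)

  ∣N[A∪B]∣+∣N[A∩B]∣≤∣N[A]∣+∣N[B]∣ : ∀ A B →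
    ∣ N G (A ∪ B) ∣ ℕ.+ ∣ N G (A ∩ B) ∣ ℕ.≤ ∣ N G A ∣ ℕ.+ ∣ N G B ∣
  ∣N[A∪B]∣+∣N[A∩B]∣≤∣N[A]∣+∣N[B]∣ A B = begin
    ∣ N G (A ∪ B) ∣ ℕ.+ ∣ N G (A ∩ B) ∣
      ≤⟨ ℕ.+-mono-≤ (p⊆q⇒∣p∣≤∣q∣ (N[A∪B]⊆N[A]∪N[B] A B)) (p⊆q⇒∣p∣≤∣q∣ (N[A∩B]⊆N[A]∩N[B] A B)) ⟩
    ∣ N G A ∪ N G B ∣ ℕ.+ ∣ N G A ∩ N G B ∣
      ≡⟨ ∣p∪q∣+∣p∩q∣≡∣p∣+∣q∣ (N G A) (N G B) ⟩
    ∣ N G A ∣ ℕ.+ ∣ N G B ∣ ∎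
    where open ℕ.≤-Reasoning

  N[X─N[X]]∩N[X]-disjoint : ∀ X → Empty (N G (X ─ N G X) ∩ (X ∩ N G X))
  N[X─N[X]]∩N[X]-disjoint X (w , w∈both) with x∈p∩q⁻ (N G (X ─ N G X)) (X ∩ N G X) w∈both
  ... | w∈N[X─NX] , w∈X∩NX with x∈N⁻ w∈N[X─NX]
  ...   | u , u∈X─NX , adj≡true =
    x∈p─q⇒x∉q X (N G X) u∈X─NX
      (x∈N⁺ (proj₁ (x∈p∩q⁻ X (N G X) w∈X∩NX)) (trans (Graph.sym G w u) adj≡true))

  d-⊥ : d G ⊥ ≡ 0ℤ
  d-⊥ = cong₂ (λ a b → + a - + b) (∣⊥∣≡0 n) (Empty⇒∣p∣≡0 N[⊥]-empty)
    where
    N[⊥]-empty : Empty (N G ⊥)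
    N[⊥]-empty (x , x∈N⊥) = ∉⊥ (proj₁ (proj₂ (x∈N⁻ x∈N⊥)))

  0<d⇒Nonempty : ∀ {A} → 0ℤ < d G A → Nonempty A
  0<d⇒Nonempty {A} 0<dA with nonempty? A
  ... | yes A-nonempty = A-nonempty
  ... | no  A-empty    = contradiction (subst (0ℤ <_) d[A]≡0 0<dA) (ℤ.<-irrefl refl)
    where
    d[A]≡0 : d G A ≡ 0ℤ
    d[A]≡0 = trans (cong (d G) (Empty-unique A-empty)) d-⊥

  d[A]+d[B]≤d[A∪B]+d[A∩B] : ∀ A B → d G A + d G B ≤ d G (A ∪ B) + d G (A ∩ B)
  d[A]+d[B]≤d[A∪B]+d[A∩B] A B = begin
    d G A + d G B
      ≡⟨ [+a-+b]+[+c-+e]≡+[a+c]-+[b+e] (∣ A ∣) (∣ N G A ∣) (∣ B ∣) (∣ N G B ∣) ⟩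
    + (∣ A ∣ ℕ.+ ∣ B ∣) - + (∣ N G A ∣ ℕ.+ ∣ N G B ∣)
      ≤⟨ i-j≤i′-j′ (ℤ.≤-reflexive (cong (+_) (≡.sym (∣p∪q∣+∣p∩q∣≡∣p∣+∣q∣ A B))))
                   (ℤ.+≤+ (∣N[A∪B]∣+∣N[A∩B]∣≤∣N[A]∣+∣N[B]∣ A B)) ⟩
    + (∣ A ∪ B ∣ ℕ.+ ∣ A ∩ B ∣) - + (∣ N G (A ∪ B) ∣ ℕ.+ ∣ N G (A ∩ B) ∣)
      ≡⟨ ≡.sym ([+a-+b]+[+c-+e]≡+[a+c]-+[b+e] (∣ A ∪ B ∣) (∣ N G (A ∪ B) ∣) (∣ A ∩ B ∣) (∣ N G (A ∩ B) ∣)) ⟩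
    d G (A ∪ B) + d G (A ∩ B) ∎
    where open ℤ.≤-Reasoning

  d[X]≤d[X─N[X]] : ∀ X → d G X ≤ d G (X ─ N G X)
  d[X]≤d[X─N[X]] X = begin
    + ∣ X ∣ - + ∣ N G X ∣
      ≡⟨ cong (λ k → + k - + ∣ N G X ∣) (≡.sym (∣p─q∣+∣p∩q∣≡∣p∣ X (N G X))) ⟩
    + (∣ I ∣ ℕ.+ ∣ K ∣) - + ∣ N G X ∣
      ≤⟨ i-j≤i′-j′ (ℤ.≤-refl {+ (∣ I ∣ ℕ.+ ∣ K ∣)}) (ℤ.+≤+ ∣N[I]∣+∣K∣≤∣N[X]∣) ⟩
    + (∣ I ∣ ℕ.+ ∣ K ∣) - + (∣ N G I ∣ ℕ.+ ∣ K ∣)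
      ≡⟨ +[a+k]-+[b+k]≡+a-+b (∣ I ∣) (∣ N G I ∣) (∣ K ∣) ⟩
    + ∣ I ∣ - + ∣ N G I ∣ ∎
    where
    open ℤ.≤-Reasoning
    I K : Subset n
    I = X ─ N G X
    K = X ∩ N G X
    ∣N[I]∣+∣K∣≤∣N[X]∣ : ∣ N G I ∣ ℕ.+ ∣ K ∣ ℕ.≤ ∣ N G X ∣
    ∣N[I]∣+∣K∣≤∣N[X]∣ = disjoint⇒∣p∣+∣q∣≤∣r∣ (N[X─N[X]]∩N[X]-disjoint X) (N-mono (p─q⊆p X (N G X))) (p∩q⊆q X (N G X))

  d<d[Z∪S] : ∀ Z {S} → MinimalPositive G S → Z ∩ S ⊂ S → d G Z < d G (Z ∪ S)
  d<d[Z∪S] Z {S} (0<dS , S-minimal) Z∩S⊂S = begin-strict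
    d G Z                         ≡⟨ ≡.sym (ℤ.+-identityʳ (d G Z)) ⟩
    d G Z + 0ℤ                    <⟨ ℤ.+-monoʳ-< (d G Z) 0<dS ⟩
    d G Z + d G S                 ≤⟨ d[A]+d[B]≤d[A∪B]+d[A∩B] Z S ⟩
    d G (Z ∪ S) + d G (Z ∩ S)     ≤⟨ ℤ.+-monoʳ-≤ (d G (Z ∪ S)) (ℤ.≮⇒≥ (S-minimal (Z ∩ S) Z∩S⊂S)) ⟩
    d G (Z ∪ S) + 0ℤ              ≡⟨ ℤ.+-identityʳ (d G (Z ∪ S)) ⟩
    d G (Z ∪ S)                   ∎
    where open ℤ.≤-Reasoning

  d≤d[Z∪S] : ∀ Z {S} → MinimalPositive G S → d G Z ≤ d G (Z ∪ S)
  d≤d[Z∪S] Z {S} S-minimal with (Z ∩ S) ⊂? S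
  ... | yes Z∩S⊂S = ℤ.<⇒≤ (d<d[Z∪S] Z S-minimal Z∩S⊂S)
  ... | no  Z∩S⊄S = ℤ.≤-reflexive (cong (d G) (≡.sym Z∪S≡Z))
    where
    S⊆Z : S ⊆ Z
    S⊆Z x∈S = p∩q⊆p Z S (p⊆q∧p⊄q⇒q⊆p (p∩q⊆q Z S) Z∩S⊄S x∈S)
    Z∪S≡Z : Z ∪ S ≡ Z
    Z∪S≡Z = trans (∪-comm Z S) (p⊆q⇒p∪q≡q S⊆Z)

  d≤d[Z∪⋃Ss] : ∀ Z {Ss} → All (MinimalPositive G) Ss → d G Z ≤ d G (Z ∪ ⋃ Ss)
  d≤d[Z∪⋃Ss] Z []                        = ℤ.≤-reflexive (cong (d G) (≡.sym (∪-identityʳ Z)))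
  d≤d[Z∪⋃Ss] Z {S ∷ Ss} (S-minimal ∷ Ss-minimal) =
    subst (d G Z ≤_) (cong (d G) (∪-assoc Z S (⋃ Ss)))
      (ℤ.≤-trans (d≤d[Z∪S] Z S-minimal) (d≤d[Z∪⋃Ss] (Z ∪ S) Ss-minimal))

  d<d[Z∪⋃Ss] : ∀ Z {Ss x} → All (MinimalPositive G) Ss → x ∈ ⋃ Ss → x ∉ Z → d G Z < d G (Z ∪ ⋃ Ss)
  d<d[Z∪⋃Ss] Z []                        x∈⊥ _ = contradiction x∈⊥ ∉⊥
  d<d[Z∪⋃Ss] Z {S ∷ Ss} {x} (S-minimal ∷ Ss-minimal) x∈⋃ x∉Z =
    subst (d G Z <_) (cong (d G) (∪-assoc Z S (⋃ Ss))) (d<d[[Z∪S]∪⋃Ss] (x ∈? S))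
    where
    d<d[[Z∪S]∪⋃Ss] : Dec (x ∈ S) → d G Z < d G ((Z ∪ S) ∪ ⋃ Ss)
    d<d[[Z∪S]∪⋃Ss] (yes x∈S) =
      ℤ.<-≤-trans (d<d[Z∪S] Z S-minimal (p∩q⊆q Z S , x , x∈S , x∉Z ∘ proj₁ ∘ x∈p∩q⁻ Z S))
                  (d≤d[Z∪⋃Ss] (Z ∪ S) Ss-minimal)
    d<d[[Z∪S]∪⋃Ss] (no x∉S) =
      ℤ.≤-<-trans (d≤d[Z∪S] Z S-minimal)
                  (d<d[Z∪⋃Ss] (Z ∪ S) Ss-minimal x∈⋃Ss ([ x∉Z , x∉S ]′ ∘ x∈p∪q⁻ Z S))
      where
      x∈⋃Ss : x ∈ ⋃ Ss
      x∈⋃Ss = [ (λ x∈S → contradiction x∈S x∉S) , id ]′ (x∈p∪q⁻ S (⋃ Ss) x∈⋃)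

  ⋃-Nonempty : ∀ {Ss} → ¬ Ss ≡ [] → All (MinimalPositive G) Ss → Nonempty (⋃ Ss)
  ⋃-Nonempty {[]}    []≢[] _                       = contradiction refl []≢[]
  ⋃-Nonempty {S ∷ _} _     ((0<dS , _) ∷ _) with 0<d⇒Nonempty 0<dS
  ... | x , x∈S = x , x∈p∪q⁺ (inj₁ x∈S)

theorem2p14 : ∀ {n} (G : Graph n) (X : Subset n) →
    ∃ (λ (Ss : List (Subset n)) → ¬ (Ss ≡ []) × All (MinimalPositive G) Ss × X ≡ ⋃ Ss) →
    Independent G X × (0ℤ < d G X) × (∀ Y → Y ⊂ X → d G Y < d G X)
theorem2p14 G X (Ss , Ss≢[] , Ss-minimal , refl) = independent , positive , maximal
  where
  maximal : ∀ Y → Y ⊂ X → d G Y < d G X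
  maximal Y (Y⊆X , x , x∈X , x∉Y) =
    subst (d G Y <_) (cong (d G) (p⊆q⇒p∪q≡q Y⊆X)) (d<d[Z∪⋃Ss] G Y Ss-minimal x∈X x∉Y)

  positive : 0ℤ < d G X
  positive with ⋃-Nonempty G Ss≢[] Ss-minimal
  ... | x , x∈X = subst (_< d G X) (d-⊥ G) (maximal ⊥ (⊥⊆ , x , x∈X , ∉⊥))

  independent : Independent G X
  independent u v u∈X v∈X with adj G u v in adj≡
  ... | false = refl
  ... | true  = contradiction (maximal (X ─ N G X) X─N[X]⊂X) (ℤ.≤⇒≯ (d[X]≤d[X─N[X]] G X))
    where
    X─N[X]⊂X : X ─ N G X ⊂ X
    X─N[X]⊂X = p∩q≢∅⇒p─q⊂p X (N G X) (v , x∈p∩q⁺ (v∈X , x∈N⁺ G u∈X adj≡))
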